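{- Let $p,q$ be propositional variables. Over the class of here-and-there models, $p\,\mathsf U\,q$ is $\mathsf L_{\mathsf R}$-definable: there is a formula $\varphi$ built from propositional variables using only $\bot,\wedge,\vee,\to,\bigcirc,\mathsf R$ such that $(p\,\mathsf U\,q)\leftrightarrow\varphi$ is valid over all here-and-there models.
   Context: A model is $(W,\preccurlyeq,S,V)$ with $\preccurlyeq$ a partial order on nonempty $W$, $S\colon W\to W$ forward confluent ($w\preccurlyeq v\Rightarrow S(w)\preccurlyeq S(v)$), and monotone $V\colon W\to\mathcal P(\mathbb P)$. Satisfaction: atoms by $V$; $\bot$ false; $\wedge,\vee$ classical; $w\models\bigcirc\varphi$ iff $S(w)\models\varphi$; $w\models\varphi\to\psi$ iff every $v\succcurlyeq w$ with $v\models\varphi$ has $v\models\psi$; $w\models\varphi\,\mathsf U\,\psi$ iff some $k\ge0$ has $S^k(w)\models\psi$ and $S^i(w)\models\varphi$ for all $i<k$; $w\models\varphi\,\mathsf R\,\psi$ iff for all $k\ge0$, $S^k(w)\models\psi$ or $S^i(w)\models\varphi$ for some $i<k$. A here-and-there model is a model with $W=T\times\{0,1\}$ for some set $T$ such that there is $f\colon T\to T$ with $(t,i)\preccurlyeq(s,j)$ iff $t=s$ and $i\le j$, and $S(t,i)=(f(t),i)$. -}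

module Defs where

open import Data.Nat using (ℕ; zero; suc; _<_; _≤_)
open import Data.Product using (Σ; _×_; _,_)
open import Data.Sum using (_⊎_)
open import Data.Empty using (⊥)
open import Data.Unit using (⊤)
open import Level using (Level; suc) renaming (zero to lzero)
open import Relation.Binary.PropositionalEquality using (_≡_; refl; sym; trans; cong; isEquivalence)
open import Relation.Binary.Structures using (IsPartialOrder)
open import Relation.Nullary using (Dec)

Atom : Set
Atom = ℕ

data Formula : Set where
  var  : Atom → Formula
  ⊥'   : Formula
  _∧'_ : Formula → Formula → Formula
  _∨'_ : Formula → Formula → Formula
  _⇒_  : Formula → Formula → Formula
  ○_   : Formula → Formula
  _U_  : Formula → Formula → Formula
  _R_  : Formula → Formula → Formula

_⇔'_ : Formula → Formula → Formula
φ ⇔' ψ = (φ ⇒ ψ) ∧' (ψ ⇒ φ)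

data InLR : Formula → Set where
  var : ∀ a → InLR (var a)
  ⊥'  : InLR ⊥'
  _∧'_ : ∀ {φ ψ} → InLR φ → InLR ψ → InLR (φ ∧' ψ)
  _∨'_ : ∀ {φ ψ} → InLR φ → InLR ψ → InLR (φ ∨' ψ)
  _⇒_  : ∀ {φ ψ} → InLR φ → InLR ψ → InLR (φ ⇒ ψ)
  ○_   : ∀ {φ} → InLR φ → InLR (○ φ)
  _R_  : ∀ {φ ψ} → InLR φ → InLR ψ → InLR (φ R ψ)

iter : {A : Set} → (A → A) → ℕ → A → A
iter f zero    x = x
iter f (suc n) x = f (iter f n x)

record Model : Set₁ where
  field
    W         : Set
    _≼_       : W → W → Set
    isPO      : IsPartialOrder _≡_ _≼_
    S         : W → W
    S-conf    : ∀ {w v} → w ≼ v → S w ≼ S v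
    V         : W → Atom → Set
    V-mono    : ∀ {w v} a → w ≼ v → V w a → V v a

module _ (M : Model) where
  open Model M

  _⊨_ : W → Formula → Set
  w ⊨ var a   = V w a
  w ⊨ ⊥'      = ⊥
  w ⊨ (φ ∧' ψ) = (w ⊨ φ) × (w ⊨ ψ)
  w ⊨ (φ ∨' ψ) = (w ⊨ φ) ⊎ (w ⊨ ψ)
  w ⊨ (φ ⇒ ψ) = ∀ v → w ≼ v → v ⊨ φ → v ⊨ ψ
  w ⊨ (○ φ)   = S w ⊨ φ
  w ⊨ (φ U ψ) = Σ ℕ λ k → (iter S k w ⊨ ψ) × (∀ i → i < k → iter S i w ⊨ φ)
  w ⊨ (φ R ψ) = ∀ k → (iter S k w ⊨ ψ) ⊎ (Σ ℕ λ i → (i < k) × (iter S i w ⊨ φ))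

-- Here-and-there models: W = T × {0,1}, (t,i) ≼ (s,j) iff
-- t = s and i ≤ j, and S (t , i) = (f t , i).
data Two : Set where
  𝟘 𝟙 : Two

data _≤₂_ : Two → Two → Set where
  0≤0 : 𝟘 ≤₂ 𝟘
  0≤1 : 𝟘 ≤₂ 𝟙
  1≤1 : 𝟙 ≤₂ 𝟙

HTWorld : Set → Set
HTWorld T = T × Two

_≼HT_ : {T : Set} → HTWorld T → HTWorld T → Set
(t , i) ≼HT (s , j) = (t ≡ s) × (i ≤₂ j)

HTSucc : {T : Set} → (T → T) → HTWorld T → HTWorld T
HTSucc f (t , i) = (f t , i)

HTMonotone : {T : Set} → (HTWorld T → Atom → Set) → Set
HTMonotone {T} V = ∀ {w v} a → w ≼HT v → V w a → V v a

≤₂-refl : ∀ {i} → i ≤₂ i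
≤₂-refl {𝟘} = 0≤0
≤₂-refl {𝟙} = 1≤1

≤₂-trans : ∀ {i j k} → i ≤₂ j → j ≤₂ k → i ≤₂ k
≤₂-trans 0≤0 q = q
≤₂-trans 0≤1 1≤1 = 0≤1
≤₂-trans 1≤1 1≤1 = 1≤1

≤₂-antisym : ∀ {i j} → i ≤₂ j → j ≤₂ i → i ≡ j
≤₂-antisym 0≤0 _ = refl
≤₂-antisym 0≤1 ()
≤₂-antisym 1≤1 _ = refl

≼HT-isPO : {T : Set} → IsPartialOrder {A = HTWorld T} _≡_ _≼HT_
≼HT-isPO {T} = record
  { isPreorder = record
    { isEquivalence = isEquivalence
    ; reflexive = λ { refl → refl , ≤₂-refl }
    ; trans = λ { {_ , _} {_ , _} {_ , _} (refl , p) (refl , q) → refl , ≤₂-trans p q }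
    }
  ; antisym = λ { {_ , _} {_ , _} (refl , p) (_ , q) → cong (_ ,_) (≤₂-antisym p q) }
  }
  where open import Data.Product using (_,_)

HTSucc-conf : {T : Set} (f : T → T) → ∀ {w v : HTWorld T} →
              w ≼HT v → HTSucc f w ≼HT HTSucc f v
HTSucc-conf f {_ , _} {_ , _} (refl , p) = refl , p

htModel : (T : Set) (f : T → T) (V : HTWorld T → Atom → Set) →
          HTMonotone V → Model
htModel T f V mono = record
  { W = HTWorld T
  ; _≼_ = _≼HT_
  ; isPO = ≼HT-isPO
  ; S = HTSucc f
  ; S-conf = HTSucc-conf f
  ; V = V
  ; V-mono = mono
  }

HTValid : Formula → Set₁
HTValid φ = ∀ (T : Set) (f : T → T) (V : HTWorld T → Atom → Set)
              (mono : HTMonotone V) (w : HTWorld T) →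
              _⊨_ (htModel T f V mono) w φ

-- Classical metatheory (excluded middle), as used in the paper.
ExcludedMiddle : Set₁
ExcludedMiddle = (A : Set) → Dec A

-- In a here-and-there model, φ U ψ is "φ weak-until ψ", i.e. ψ R (φ ∨ ψ),
-- together with ψ eventually holding at the here-level.  The weak diamond
-- ¬□¬ψ only reaches ψ at the there-level; the gap is closed by
-- stableUntil ψ = ψ R (¬¬ψ → ψ): up to the first ψ, every there-ψ is a here-ψ,
-- so the first there-ψ is a here-ψ.  That formula is not implied by φ U ψ, so it
-- is guarded by decidedBeforeReached ψ, "ψ ∨ ¬ψ wherever ψ is later reached".
-- If ψ is reached, the guard yields stableUntil ψ by backward induction from the
-- reaching point; if ψ is never reached at the here-level, the guard holds
-- vacuously, and then stableUntil ψ ∧ ¬□¬ψ would reach ψ after all.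
module Submission where

open import Defs
open import Data.Nat using (ℕ; zero; suc; _<_; z≤n; s≤s)
open import Data.Nat.Properties using (<-cmp)
open import Data.Product using (Σ; _×_; _,_)
open import Data.Sum using (_⊎_; inj₁; inj₂)
open import Data.Empty using (⊥-elim)
open import Function using (case_of_)
open import Relation.Nullary using (¬_; yes; no)
open import Relation.Binary.PropositionalEquality using (_≡_; refl; sym; cong; subst)
open import Relation.Binary.Definitions using (tri<; tri≈; tri>)
open import Relation.Binary.Structures using (IsPartialOrder)

¬' : Formula → Formula
¬' φ = φ ⇒ ⊥'

□' : Formula → Formula
□' φ = ⊥' R φ

¬□¬ : Formula → Formula
¬□¬ φ = ¬' (□' (¬' φ))

stableUntil : Formula → Formula
stableUntil ψ = ψ R (¬' (¬' ψ) ⇒ ψ)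

reachedNext : Formula → Formula
reachedNext ψ = ○ (stableUntil ψ ∧' ¬□¬ ψ)

decidedIfReachedNext : Formula → Formula
decidedIfReachedNext ψ = reachedNext ψ ⇒ (ψ ∨' ¬' ψ)

decidedBeforeReached : Formula → Formula
decidedBeforeReached ψ = □' (decidedIfReachedNext ψ)

_Uᴿ_ : Formula → Formula → Formula
φ Uᴿ ψ = (ψ R (φ ∨' ψ)) ∧' (¬□¬ ψ ∧' (decidedBeforeReached ψ ⇒ stableUntil ψ))

¬'-InLR : ∀ {φ} → InLR φ → InLR (¬' φ)
¬'-InLR φ = φ ⇒ ⊥'

¬□¬-InLR : ∀ {φ} → InLR φ → InLR (¬□¬ φ)
¬□¬-InLR φ = ¬'-InLR (⊥' R ¬'-InLR φ)

stableUntil-InLR : ∀ {ψ} → InLR ψ → InLR (stableUntil ψ)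
stableUntil-InLR ψ = ψ R (¬'-InLR (¬'-InLR ψ) ⇒ ψ)

decidedBeforeReached-InLR : ∀ {ψ} → InLR ψ → InLR (decidedBeforeReached ψ)
decidedBeforeReached-InLR ψ =
  ⊥' R ((○ (stableUntil-InLR ψ ∧' ¬□¬-InLR ψ)) ⇒ (ψ ∨' ¬'-InLR ψ))

Uᴿ-InLR : ∀ {φ ψ} → InLR φ → InLR ψ → InLR (φ Uᴿ ψ)
Uᴿ-InLR φ ψ =
  (ψ R (φ ∨' ψ)) ∧'
  (¬□¬-InLR ψ ∧' (decidedBeforeReached-InLR ψ ⇒ stableUntil-InLR ψ))

iter-suc : {A : Set} (g : A → A) (k : ℕ) (x : A) → iter g k (g x) ≡ iter g (suc k) x
iter-suc g zero    x = refl
iter-suc g (suc k) x = cong g (iter-suc g k x)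

module Semantics (M : Model) where
  open Model M
  open IsPartialOrder isPO using () renaming (refl to ≼-refl; trans to ≼-trans)

  _⊩_ : W → Formula → Set
  _⊩_ = _⊨_ M

  Eventually : Formula → W → Set
  Eventually φ w = Σ ℕ λ k → iter S k w ⊩ φ

  later : ∀ φ k {w} → iter S k (S w) ⊩ φ → iter S (suc k) w ⊩ φ
  later φ k {w} = subst (_⊩ φ) (iter-suc S k w)

  earlier : ∀ φ k {w} → iter S (suc k) w ⊩ φ → iter S k (S w) ⊩ φ
  earlier φ k {w} = subst (_⊩ φ) (sym (iter-suc S k w))

  iter-mono : ∀ k {w v} → w ≼ v → iter S k w ≼ iter S k v
  iter-mono zero    w≼v = w≼v
  iter-mono (suc k) w≼v = S-conf (iter-mono k w≼v)

  ⊩-mono : ∀ φ {w v} → w ≼ v → w ⊩ φ → v ⊩ φ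
  ⊩-mono (var a)  w≼v x = V-mono a w≼v x
  ⊩-mono (φ ∧' ψ) w≼v (x , y) = ⊩-mono φ w≼v x , ⊩-mono ψ w≼v y
  ⊩-mono (φ ∨' ψ) w≼v (inj₁ x) = inj₁ (⊩-mono φ w≼v x)
  ⊩-mono (φ ∨' ψ) w≼v (inj₂ y) = inj₂ (⊩-mono ψ w≼v y)
  ⊩-mono (φ ⇒ ψ)  w≼v h u v≼u = h u (≼-trans w≼v v≼u)
  ⊩-mono (○ φ)    w≼v x = ⊩-mono φ (S-conf w≼v) x
  ⊩-mono (φ U ψ)  w≼v (k , x , y) =
    k , ⊩-mono ψ (iter-mono k w≼v) x , λ i i<k → ⊩-mono φ (iter-mono i w≼v) (y i i<k)
  ⊩-mono (φ R ψ)  w≼v h k with h k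
  ... | inj₁ x            = inj₁ (⊩-mono ψ (iter-mono k w≼v) x)
  ... | inj₂ (i , i<k , x) = inj₂ (i , i<k , ⊩-mono φ (iter-mono i w≼v) x)

  Eventually-tail : ∀ φ {w} → Eventually φ (S w) → Eventually φ w
  Eventually-tail φ (k , x) = suc k , later φ k x

  Eventually-drop : ∀ φ k {w} → Eventually φ (iter S k w) → Eventually φ w
  Eventually-drop φ zero    e = e
  Eventually-drop φ (suc k) e = Eventually-drop φ k (Eventually-tail φ e)

  R-head : ∀ φ ψ {w} → w ⊩ (φ R ψ) → w ⊩ ψ
  R-head φ ψ h with h 0
  ... | inj₁ x = x
  ... | inj₂ (_ , () , _)

  R-tail : ∀ φ ψ {w} → w ⊩ (φ R ψ) → ¬ (w ⊩ φ) → S w ⊩ (φ R ψ)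
  R-tail φ ψ h ¬φ k with h (suc k)
  ... | inj₁ x                     = inj₁ (earlier ψ k x)
  ... | inj₂ (zero , _ , x)         = ⊥-elim (¬φ x)
  ... | inj₂ (suc i , s≤s i<k , x) = inj₂ (i , i<k , earlier φ i x)

  R-cons : ∀ φ ψ {w} → w ⊩ ψ → (w ⊩ φ) ⊎ (S w ⊩ (φ R ψ)) → w ⊩ (φ R ψ)
  R-cons φ ψ x _ zero = inj₁ x
  R-cons φ ψ _ (inj₁ y) (suc k) = inj₂ (0 , s≤s z≤n , y)
  R-cons φ ψ _ (inj₂ h) (suc k) with h k
  ... | inj₁ x            = inj₁ (later ψ k x)
  ... | inj₂ (i , i<k , y) = inj₂ (suc i , s≤s i<k , later φ i y)

  □-intro : ∀ φ {w} → (∀ k → iter S k w ⊩ φ) → w ⊩ □' φ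
  □-intro φ h k = inj₁ (h k)

  □-at : ∀ φ {w} → w ⊩ □' φ → ∀ k → iter S k w ⊩ φ
  □-at φ h k with h k
  ... | inj₁ x = x

  □-tail : ∀ φ {w} → w ⊩ □' φ → S w ⊩ □' φ
  □-tail φ h = R-tail ⊥' φ h λ ()

  U-now : ∀ φ ψ {w} → w ⊩ ψ → w ⊩ (φ U ψ)
  U-now φ ψ x = 0 , x , λ _ ()

  U-cons : ∀ φ ψ {w} → w ⊩ φ → S w ⊩ (φ U ψ) → w ⊩ (φ U ψ)
  U-cons φ ψ {w} x (k , y , z) = suc k , later ψ k y , before
    where
    before : ∀ i → i < suc k → iter S i w ⊩ φ
    before zero    _         = x
    before (suc i) (s≤s i<k) = later φ i (z i i<k)

  U⇒R : ∀ φ ψ {w} → w ⊩ (φ U ψ) → w ⊩ (ψ R (φ ∨' ψ))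
  U⇒R φ ψ (m , x , y) k with <-cmp k m
  ... | tri< k<m _ _  = inj₁ (inj₁ (y k k<m))
  ... | tri≈ _ refl _ = inj₁ (inj₂ x)
  ... | tri> _ _ m<k  = inj₂ (m , m<k , x)

  R∧iter⇒U : ExcludedMiddle → ∀ φ ψ k {w} →
             w ⊩ (ψ R (φ ∨' ψ)) → iter S k w ⊩ ψ → w ⊩ (φ U ψ)
  R∧iter⇒U lem φ ψ zero h x = U-now φ ψ x
  R∧iter⇒U lem φ ψ (suc k) {w} h x with lem (w ⊩ ψ) | R-head ψ (φ ∨' ψ) h
  ... | yes y | _       = U-now φ ψ y
  ... | no ¬y | inj₁ φw =
    U-cons φ ψ φw (R∧iter⇒U lem φ ψ k (R-tail ψ (φ ∨' ψ) h ¬y) (earlier ψ k x))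
  ... | no ¬y | inj₂ y  = ⊥-elim (¬y y)

  Eventually⇒¬□¬ : ∀ φ {w} → Eventually φ w → w ⊩ ¬□¬ φ
  Eventually⇒¬□¬ φ (k , x) v w≼v □¬φ =
    □-at (¬' φ) □¬φ k (iter S k v) ≼-refl (⊩-mono φ (iter-mono k w≼v) x)

module HereThere (lem : ExcludedMiddle) (T : Set) (f : T → T)
                 (V : HTWorld T → Atom → Set) (mono : HTMonotone V) where
  open Semantics (htModel T f V mono)
  open Model (htModel T f V mono) using (S)
  open IsPartialOrder (≼HT-isPO {T}) using () renaming (refl to ≼-refl)

  there : HTWorld T → HTWorld T
  there (t , _) = t , 𝟙

  ≤₂-𝟙 : ∀ i → i ≤₂ 𝟙
  ≤₂-𝟙 𝟘 = 0≤1
  ≤₂-𝟙 𝟙 = 1≤1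

  ≼-there : ∀ w → w ≼HT there w
  ≼-there (_ , i) = refl , ≤₂-𝟙 i

  ≼⇒≼-there : ∀ {w v} → w ≼HT v → v ≼HT there w
  ≼⇒≼-there {v = _ , j} (refl , _) = refl , ≤₂-𝟙 j

  iter-there : ∀ k w → iter S k (there w) ≡ there (iter S k w)
  iter-there zero    w = refl
  iter-there (suc k) w = cong S (iter-there k w)

  ¬-there : ∀ φ w → ¬ (there w ⊩ φ) → there w ⊩ ¬' φ
  ¬-there φ w ¬x (_ , 𝟙) (refl , 1≤1) x = ¬x x

  excluded-middle-there : ∀ φ w → (there w ⊩ φ) ⊎ (there w ⊩ ¬' φ)
  excluded-middle-there φ w with lem (there w ⊩ φ)
  ... | yes x = inj₁ x
  ... | no ¬x = inj₂ (¬-there φ w ¬x)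

  ¬¬-there : ∀ φ {w} → w ⊩ ¬' (¬' φ) → there w ⊩ φ
  ¬¬-there φ {w} h with excluded-middle-there φ w
  ... | inj₁ x  = x
  ... | inj₂ ¬x = ⊥-elim (h (there w) (≼-there w) ¬x)

  there⇒¬¬ : ∀ φ {w} → there w ⊩ φ → w ⊩ ¬' (¬' φ)
  there⇒¬¬ φ {w} x v w≼v ¬φ = ¬φ (there w) (≼⇒≼-there w≼v) x

  ¬¬-stable : ∀ φ {w} → (there w ⊩ φ → w ⊩ φ) → w ⊩ (¬' (¬' φ) ⇒ φ)
  ¬¬-stable φ g _ (refl , 0≤0) h = g (¬¬-there φ h)
  ¬¬-stable φ g _ (refl , 0≤1) h = ¬¬-there φ h
  ¬¬-stable φ g _ (refl , 1≤1) h = ¬¬-there φ h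

  ¬□¬⇒there : ∀ φ {w} → w ⊩ ¬□¬ φ → Σ ℕ λ k → there (iter S k w) ⊩ φ
  ¬□¬⇒there φ {w} h with lem (Σ ℕ λ k → there (iter S k w) ⊩ φ)
  ... | yes e = e
  ... | no ¬e = ⊥-elim (h (there w) (≼-there w) (□-intro (¬' φ) never))
    where
    never : ∀ k → iter S k (there w) ⊩ ¬' φ
    never k = subst (_⊩ ¬' φ) (sym (iter-there k w))
                    (¬-there φ (iter S k w) λ x → ¬e (k , x))

  stableUntil-reaches : ∀ ψ {w} → w ⊩ stableUntil ψ → w ⊩ ¬□¬ ψ → Eventually ψ w
  stableUntil-reaches ψ {w} h n with ¬□¬⇒there ψ n
  ... | k , x with h k
  ...   | inj₁ stable      = k , stable (iter S k w) ≼-refl (there⇒¬¬ ψ x)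
  ...   | inj₂ (i , _ , y) = i , y

  decided⇒stableUntil : ∀ ψ k {w} → w ⊩ decidedBeforeReached ψ → iter S k w ⊩ ψ →
                        w ⊩ stableUntil ψ
  decided⇒stableUntil ψ zero _ x =
    R-cons ψ (¬' (¬' ψ) ⇒ ψ) (λ v w≼v _ → ⊩-mono ψ w≼v x) (inj₁ x)
  decided⇒stableUntil ψ (suc k) {w} d x = R-cons ψ (¬' (¬' ψ) ⇒ ψ) stable (inj₂ next)
    where
    next : S w ⊩ stableUntil ψ
    next = decided⇒stableUntil ψ k (□-tail (decidedIfReachedNext ψ) d) (earlier ψ k x)

    decided : (w ⊩ ψ) ⊎ (w ⊩ ¬' ψ)
    decided = □-at (decidedIfReachedNext ψ) d 0 w ≼-refl
                (next , Eventually⇒¬□¬ ψ (k , earlier ψ k x))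

    stable : w ⊩ (¬' (¬' ψ) ⇒ ψ)
    stable = ¬¬-stable ψ λ ψ-there → case decided of λ
      { (inj₁ ψw)  → ψw
      ; (inj₂ ¬ψw) → ⊥-elim (¬ψw (there w) (≼-there w) ψ-there) }

  never⇒decided : ∀ ψ {w} → ¬ Eventually ψ w → w ⊩ decidedBeforeReached ψ
  never⇒decided ψ never = □-intro (decidedIfReachedNext ψ) λ k →
    decided-at (λ e → never (Eventually-drop ψ k e))
    where
    decided-at : ∀ {u} → ¬ Eventually ψ u → u ⊩ decidedIfReachedNext ψ
    decided-at {_ , 𝟘} ¬reached (_ , 𝟘) (refl , 0≤0) (y , n) =
      ⊥-elim (¬reached (Eventually-tail ψ (stableUntil-reaches ψ y n)))
    decided-at {_ , 𝟙} _ (_ , 𝟘) (_ , ()) _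
    decided-at _ v@(_ , 𝟙) _ _ = excluded-middle-there ψ v

  U⇒Uᴿ : ∀ φ ψ {w} → w ⊩ (φ U ψ) → w ⊩ (φ Uᴿ ψ)
  U⇒Uᴿ φ ψ h@(k , x , _) =
    U⇒R φ ψ h , Eventually⇒¬□¬ ψ (k , x) ,
    λ v w≼v d → decided⇒stableUntil ψ k d (⊩-mono ψ (iter-mono k w≼v) x)

  Uᴿ⇒U : ∀ φ ψ {w} → w ⊩ (φ Uᴿ ψ) → w ⊩ (φ U ψ)
  Uᴿ⇒U φ ψ {w} (r , n , decided⇒stable) with lem (Eventually ψ w)
  ... | yes (k , x) = R∧iter⇒U lem φ ψ k r x
  ... | no never    = ⊥-elim (never (stableUntil-reaches ψ stable n))
    where
    stable : w ⊩ stableUntil ψ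
    stable = decided⇒stable w ≼-refl (never⇒decided ψ never)

  U⇔Uᴿ : ∀ φ ψ w → w ⊩ ((φ U ψ) ⇔' (φ Uᴿ ψ))
  U⇔Uᴿ φ ψ w = (λ _ _ → U⇒Uᴿ φ ψ) , (λ _ _ → Uᴿ⇒U φ ψ)

corollary8p4 : (p q : Atom) →
    Σ Formula λ φ → InLR φ × (ExcludedMiddle → HTValid ((var p U var q) ⇔' φ))
corollary8p4 p q =
  var p Uᴿ var q , Uᴿ-InLR (var p) (var q) ,
  λ lem T f V mono → HereThere.U⇔Uᴿ lem T f V mono (var p) (var q)
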